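{- Let $G$ be a group and let $x\in G$ have order $p^n$ for a prime $p$. Then $x$ cannot be a vertex with out-edges in a hole of even length in the power graph $\mathfrak{g}(G)$; that is, there is no hole of even length in $\mathfrak{g}(G)$ containing $x$ in which both neighbours of $x$ on the hole lie in $\langle x\rangle$.
   Context: The power graph $\mathfrak{g}(G)$ has vertex set $G$, distinct $x,y$ adjacent iff $\langle x\rangle\le\langle y\rangle$ or $\langle y\rangle\le\langle x\rangle$. A hole is a cycle in the graph such that no two of its vertices are joined by an edge not belonging to the cycle (a chordless/induced cycle). In the directed power graph an edge goes from $x$ to $y$ when $y\ne x$ and $\langle y\rangle\le\langle x\rangle$; a vertex "with out-edges" in a hole is one whose two hole-edges are both directed away from it, i.e. both its neighbours on the hole are powers of it. -}

module Defs where

open import Level using (Level; _⊔_)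
open import Algebra.Bundles using (Group)
open import Data.Nat using (ℕ; zero; suc; _<_)
open import Data.Integer using (ℤ; +_; -[1+_])
open import Data.Fin using (Fin; toℕ)
open import Data.Product using (Σ; ∃; _×_; _,_)
open import Data.Sum using (_⊎_)
open import Relation.Nullary using (¬_)
open import Relation.Binary.PropositionalEquality using (_≡_)

-- j ≡ i + 1 (mod m), for indices i , j < m
Next : ℕ → ℕ → ℕ → Set
Next m i j = (j ≡ suc i) ⊎ ((suc i ≡ m) × (j ≡ 0))

module PowerGraph {c ℓ : Level} (G : Group c ℓ) where
  open Group G

  _^ℕ_ : Carrier → ℕ → Carrier
  x ^ℕ zero  = ε
  x ^ℕ suc n = x ∙ (x ^ℕ n)

  _^ℤ_ : Carrier → ℤ → Carrier
  x ^ℤ (+ n)      = x ^ℕ n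
  x ^ℤ -[1+ n ]   = (x ^ℕ suc n) ⁻¹

  _∈⟨_⟩ : Carrier → Carrier → Set ℓ
  y ∈⟨ x ⟩ = ∃ λ (k : ℤ) → y ≈ x ^ℤ k

  HasOrder : Carrier → ℕ → Set ℓ
  HasOrder x n = (0 < n) × (x ^ℕ n ≈ ε) × (∀ k → 0 < k → k < n → ¬ (x ^ℕ k ≈ ε))

  Adj : Carrier → Carrier → Set ℓ
  Adj x y = ¬ (x ≈ y) × (x ∈⟨ y ⟩ ⊎ y ∈⟨ x ⟩)

  record IsHole (m : ℕ) (v : Fin m → Carrier) : Set (c ⊔ ℓ) where
    field
      length≥3  : 3 Data.Nat.≤ m
      distinct  : ∀ i j → v i ≈ v j → i ≡ j
      cycleEdge : ∀ (i j : Fin m) → Next m (toℕ i) (toℕ j) → Adj (v i) (v j)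
      chordless : ∀ (i j : Fin m) → Adj (v i) (v j) →
                    (Next m (toℕ i) (toℕ j)) ⊎ (Next m (toℕ j) (toℕ i))

  CycNbr : ∀ {m} → Fin m → Fin m → Set
  CycNbr {m} i j = (Next m (toℕ i) (toℕ j)) ⊎ (Next m (toℕ j) (toℕ i))

-- When x has order p ^ n the cyclic subgroups inside ⟨x⟩ form a chain: the divisors of p ^ n are totally
-- ordered by divisibility, and x ^ k ∈ ⟨x ^ l⟩ as soon as gcd (l , p ^ n) divides k (Bézout). So any two
-- distinct elements of ⟨x⟩ are adjacent in the power graph. On a hole of even length, hence of length at
-- least four, the two neighbours of a vertex are distinct and not adjacent, so they cannot both lie in ⟨x⟩.
module Submission where

open import Defs
open import Level using (Level)
open import Algebra.Bundles using (Group)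
open import Data.Nat using (ℕ; _^_)
open import Data.Nat.Divisibility using (_∣_)
open import Data.Nat.Primality using (Prime)
open import Data.Fin using (Fin)
open import Data.Product using (_×_)
open import Relation.Nullary using (¬_)

open import Data.Nat using (zero; suc; _+_; _*_; _∸_; _≤_; _<_; z≤n; s≤s; NonZero)
open import Data.Nat.Properties
  using ( *-comm; ^-distribˡ-+-*; m+[n∸m]≡n; m^n≢0; suc-injective; 1+n≢n
        ; ≤-refl; ≤-trans; ≤-total; n≤1+n; m≤n+m; m≤n⇒m<n∨m≡n; <⇒≢ )
open import Data.Nat.Divisibility using (divides; _∣?_; ∣1⇒≡1; ∣-trans; *-cancelˡ-∣)
open import Data.Nat.Primality using (prime⇒irreducible; prime⇒nonZero)
open import Data.Nat.Coprimality using (Coprime; coprime-divisor)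
open import Data.Nat.GCD using (gcd; gcd-GCD; gcd[m,n]∣m; gcd[m,n]∣n; module Bézout)
open import Data.Nat.Tactic.RingSolver using (solve)
open import Data.List using (_∷_; [])
open import Data.Fin using (toℕ; fromℕ<)
open import Data.Fin.Properties using (toℕ<n; toℕ-fromℕ<)
open import Data.Product using (∃; ∃₂; _,_)
open import Data.Sum as Sum using (_⊎_; inj₁; inj₂)
open import Data.Empty using (⊥-elim)
open import Function using (_∘_)
open import Data.Integer using (+_; -[1+_])
open import Relation.Nullary using (yes; no)
open import Relation.Binary.PropositionalEquality as ≡ using (_≡_; _≢_; cong; subst)
import Algebra.Properties.Group as GroupProperties
import Algebra.Properties.Monoid.Mult as MonoidMult
import Relation.Binary.Reasoning.Setoid as SetoidReasoning

-- Congruence modulo N with the multiples of N added on both sides, so that no subtraction occurs.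
infix 4 _≡_[mod_]

_≡_[mod_] : ℕ → ℕ → ℕ → Set
a ≡ b [mod N ] = ∃₂ λ s t → a + N * s ≡ b + N * t

bézout⇒≡multiple : ∀ {d l N k} .{{_ : NonZero N}} → Bézout.Identity d l N → d ∣ k →
                   ∃ λ c → k ≡ l * c [mod N ]
bézout⇒≡multiple {d} {l} {suc N′} (Bézout.+- x y d+yN≡xl) (divides q ≡.refl) =
  q * x , q * y , 0 , (begin
    q * d + suc N′ * (q * y)   ≡⟨ solve (q ∷ d ∷ N′ ∷ y ∷ []) ⟩
    q * (d + y * suc N′)       ≡⟨ cong (q *_) d+yN≡xl ⟩
    q * (x * l)                ≡⟨ solve (q ∷ x ∷ l ∷ N′ ∷ []) ⟩
    l * (q * x) + suc N′ * 0   ∎)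
  where open ≡.≡-Reasoning
-- Here − x q is represented modulo N by (N − 1) x q.
bézout⇒≡multiple {d} {l} {suc N′} (Bézout.-+ x y d+xl≡yN) (divides q ≡.refl) =
  N′ * x * q , x * q * l , q * y , (begin
    q * d + suc N′ * (x * q * l)          ≡⟨ solve (q ∷ d ∷ N′ ∷ x ∷ l ∷ []) ⟩
    q * (d + x * l) + l * (N′ * x * q)    ≡⟨ cong (λ z → q * z + l * (N′ * x * q)) d+xl≡yN ⟩
    q * (y * suc N′) + l * (N′ * x * q)   ≡⟨ solve (q ∷ y ∷ N′ ∷ l ∷ x ∷ []) ⟩
    l * (N′ * x * q) + suc N′ * (q * y)   ∎)
  where open ≡.≡-Reasoning

gcd∣⇒≡multiple : ∀ l N .{{_ : NonZero N}} {k} → gcd l N ∣ k → ∃ λ c → k ≡ l * c [mod N ]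
gcd∣⇒≡multiple l N = bézout⇒≡multiple (Bézout.identity (gcd-GCD l N))

∣p^n⇒≡p^s : ∀ {p} → Prime p → ∀ n {d} → d ∣ p ^ n → ∃ λ s → d ≡ p ^ s
∣p^n⇒≡p^s p-prime zero d∣1 = 0 , ∣1⇒≡1 d∣1
∣p^n⇒≡p^s {p} p-prime (suc n) {d} d∣p^[1+n] with p ∣? d
... | yes (divides q d≡qp) =
  let instance _ = prime⇒nonZero p-prime
      d≡pq = ≡.trans d≡qp (*-comm q p)
      (s , q≡p^s) = ∣p^n⇒≡p^s p-prime n (*-cancelˡ-∣ p (subst (_∣ p ^ suc n) d≡pq d∣p^[1+n]))
  in suc s , ≡.trans d≡pq (cong (p *_) q≡p^s)
... | no p∤d = ∣p^n⇒≡p^s p-prime n (coprime-divisor d-coprime-p d∣p^[1+n])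
  where
    d-coprime-p : Coprime d p
    d-coprime-p (e∣d , e∣p) with prime⇒irreducible p-prime e∣p
    ... | inj₁ e≡1 = e≡1
    ... | inj₂ ≡.refl = ⊥-elim (p∤d e∣d)

^-monoʳ-∣ : ∀ m {s t} → s ≤ t → m ^ s ∣ m ^ t
^-monoʳ-∣ m {s} {t} s≤t = divides (m ^ (t ∸ s)) (begin
  m ^ t                 ≡⟨ cong (m ^_) (m+[n∸m]≡n s≤t) ⟨
  m ^ (s + (t ∸ s))     ≡⟨ ^-distribˡ-+-* m s (t ∸ s) ⟩
  m ^ s * m ^ (t ∸ s)   ≡⟨ *-comm (m ^ s) _ ⟩
  m ^ (t ∸ s) * m ^ s   ∎)
  where open ≡.≡-Reasoning

∣p^n-total : ∀ {p} → Prime p → ∀ n {a b} → a ∣ p ^ n → b ∣ p ^ n → a ∣ b ⊎ b ∣ a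
∣p^n-total {p} p-prime n a∣p^n b∣p^n
  with ∣p^n⇒≡p^s p-prime n a∣p^n | ∣p^n⇒≡p^s p-prime n b∣p^n
... | s , ≡.refl | t , ≡.refl with ≤-total s t
...   | inj₁ s≤t = inj₁ (^-monoʳ-∣ p s≤t)
...   | inj₂ t≤s = inj₂ (^-monoʳ-∣ p t≤s)

≡multiple-mod-p^n-total : ∀ {p} → Prime p → ∀ n k l →
  (∃ λ c → k ≡ l * c [mod p ^ n ]) ⊎ (∃ λ c → l ≡ k * c [mod p ^ n ])
≡multiple-mod-p^n-total {p} p-prime n k l =
  Sum.map (λ gl∣gk → gcd∣⇒≡multiple l (p ^ n) (∣-trans gl∣gk (gcd[m,n]∣m k (p ^ n))))
          (λ gk∣gl → gcd∣⇒≡multiple k (p ^ n) (∣-trans gk∣gl (gcd[m,n]∣m l (p ^ n))))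
          (∣p^n-total p-prime n (gcd[m,n]∣n l (p ^ n)) (gcd[m,n]∣n k (p ^ n)))
  where instance _ = m^n≢0 p n {{prime⇒nonZero p-prime}}

module CyclicSubgroups {c ℓ : Level} (G : Group c ℓ) where
  open Group G
  open PowerGraph G
  open GroupProperties G using (inverseʳ-unique)
  open SetoidReasoning setoid
  private module Mult = MonoidMult monoid

  ^ℕ≡× : ∀ x n → x ^ℕ n ≡ n Mult.× x
  ^ℕ≡× x zero    = ≡.refl
  ^ℕ≡× x (suc n) = cong (x ∙_) (^ℕ≡× x n)

  ^ℕ-homo-+ : ∀ x m n → x ^ℕ (m + n) ≈ x ^ℕ m ∙ x ^ℕ n
  ^ℕ-homo-+ x m n = begin
    x ^ℕ (m + n)               ≡⟨ ^ℕ≡× x (m + n) ⟩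
    (m + n) Mult.× x           ≈⟨ Mult.×-homo-+ x m n ⟩
    m Mult.× x ∙ n Mult.× x    ≡⟨ ≡.cong₂ _∙_ (^ℕ≡× x m) (^ℕ≡× x n) ⟨
    x ^ℕ m ∙ x ^ℕ n            ∎

  ^ℕ-*-assoc : ∀ x m n → (x ^ℕ m) ^ℕ n ≈ x ^ℕ (m * n)
  ^ℕ-*-assoc x m n = begin
    (x ^ℕ m) ^ℕ n              ≡⟨ ≡.trans (^ℕ≡× (x ^ℕ m) n) (cong (n Mult.×_) (^ℕ≡× x m)) ⟩
    n Mult.× (m Mult.× x)      ≈⟨ Mult.×-assocˡ x n m ⟩
    (n * m) Mult.× x           ≡⟨ ≡.trans (^ℕ≡× x (m * n)) (cong (Mult._× x) (*-comm m n)) ⟨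
    x ^ℕ (m * n)               ∎

  ^ℕ-congˡ : ∀ {x y} n → x ≈ y → x ^ℕ n ≈ y ^ℕ n
  ^ℕ-congˡ {x} {y} n x≈y = begin
    x ^ℕ n          ≡⟨ ^ℕ≡× x n ⟩
    n Mult.× x      ≈⟨ Mult.×-congʳ n x≈y ⟩
    n Mult.× y      ≡⟨ ^ℕ≡× y n ⟨
    y ^ℕ n          ∎

  ε^ℕ : ∀ n → ε ^ℕ n ≈ ε
  ε^ℕ zero    = refl
  ε^ℕ (suc n) = trans (identityˡ _) (ε^ℕ n)

  module _ (x : Carrier) (N : ℕ) (x^N≈ε : x ^ℕ N ≈ ε) where

    ^ℕ-*-annihilated : ∀ n → x ^ℕ (N * n) ≈ ε
    ^ℕ-*-annihilated n = begin
      x ^ℕ (N * n)    ≈⟨ ^ℕ-*-assoc x N n ⟨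
      (x ^ℕ N) ^ℕ n   ≈⟨ ^ℕ-congˡ n x^N≈ε ⟩
      ε ^ℕ n          ≈⟨ ε^ℕ n ⟩
      ε               ∎

    ^ℕ-+-annihilated : ∀ k n → x ^ℕ (k + N * n) ≈ x ^ℕ k
    ^ℕ-+-annihilated k n = begin
      x ^ℕ (k + N * n)          ≈⟨ ^ℕ-homo-+ x k (N * n) ⟩
      x ^ℕ k ∙ x ^ℕ (N * n)     ≈⟨ ∙-congˡ (^ℕ-*-annihilated n) ⟩
      x ^ℕ k ∙ ε                ≈⟨ identityʳ _ ⟩
      x ^ℕ k                    ∎

    ^ℕ-cong-mod : ∀ {a b} → a ≡ b [mod N ] → x ^ℕ a ≈ x ^ℕ b
    ^ℕ-cong-mod {a} {b} (s , t , a+Ns≡b+Nt) = begin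
      x ^ℕ a            ≈⟨ ^ℕ-+-annihilated a s ⟨
      x ^ℕ (a + N * s)  ≡⟨ cong (x ^ℕ_) a+Ns≡b+Nt ⟩
      x ^ℕ (b + N * t)  ≈⟨ ^ℕ-+-annihilated b t ⟩
      x ^ℕ b            ∎

    ≡multiple⇒^ℕ∈⟨^ℕ⟩ : ∀ {k} l c → k ≡ l * c [mod N ] → (x ^ℕ k) ∈⟨ x ^ℕ l ⟩
    ≡multiple⇒^ℕ∈⟨^ℕ⟩ l c k≡lc = + c , trans (^ℕ-cong-mod k≡lc) (sym (^ℕ-*-assoc x l c))

  ∈⟨⟩⇒≈^ℕ : ∀ x N .{{_ : NonZero N}} → x ^ℕ N ≈ ε → ∀ {y} → y ∈⟨ x ⟩ → ∃ λ k → y ≈ x ^ℕ k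
  ∈⟨⟩⇒≈^ℕ x N x^N≈ε (+ k , y≈x^k) = k , y≈x^k
  -- x ^ -[1+ k ] is the inverse of x ^ (1 + k), which is x ^ ((N − 1) (1 + k)).
  ∈⟨⟩⇒≈^ℕ x (suc N′) x^N≈ε {y} (-[1+ k ] , y≈x^-[1+k]) = N′ * suc k , (begin
    y                        ≈⟨ y≈x^-[1+k] ⟩
    (x ^ℕ suc k) ⁻¹          ≈⟨ inverseʳ-unique _ _ x^[1+k]∙x^[N′*[1+k]]≈ε ⟨
    x ^ℕ (N′ * suc k)        ∎)
    where
      x^[1+k]∙x^[N′*[1+k]]≈ε : x ^ℕ suc k ∙ x ^ℕ (N′ * suc k) ≈ ε
      x^[1+k]∙x^[N′*[1+k]]≈ε =
        trans (sym (^ℕ-homo-+ x (suc k) _)) (^ℕ-*-annihilated x (suc N′) x^N≈ε (suc k))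

  ∈⟨⟩-resp-≈ : ∀ {a a′ b b′} → a ≈ a′ → b ≈ b′ → a′ ∈⟨ b′ ⟩ → a ∈⟨ b ⟩
  ∈⟨⟩-resp-≈ a≈a′ b≈b′ (+ n , a′≈b′^n)      = + n , trans a≈a′ (trans a′≈b′^n (^ℕ-congˡ n (sym b≈b′)))
  ∈⟨⟩-resp-≈ a≈a′ b≈b′ (-[1+ n ] , a′≈b′^z) =
    -[1+ n ] , trans a≈a′ (trans a′≈b′^z (⁻¹-cong (^ℕ-congˡ (suc n) (sym b≈b′))))

  ∈⟨⟩-total-in-p-group : ∀ {p} → Prime p → ∀ n x → x ^ℕ (p ^ n) ≈ ε →
                         ∀ {a b} → a ∈⟨ x ⟩ → b ∈⟨ x ⟩ → a ∈⟨ b ⟩ ⊎ b ∈⟨ a ⟩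
  ∈⟨⟩-total-in-p-group {p} p-prime n x x^N≈ε a∈⟨x⟩ b∈⟨x⟩ =
    let (k , a≈x^k) = ∈⟨⟩⇒≈^ℕ x N x^N≈ε a∈⟨x⟩
        (l , b≈x^l) = ∈⟨⟩⇒≈^ℕ x N x^N≈ε b∈⟨x⟩
    in Sum.map (λ (c , k≡lc) → ∈⟨⟩-resp-≈ a≈x^k b≈x^l (x^[l*c]∈⟨x^l⟩ l c k≡lc))
               (λ (c , l≡kc) → ∈⟨⟩-resp-≈ b≈x^l a≈x^k (x^[l*c]∈⟨x^l⟩ k c l≡kc))
               (≡multiple-mod-p^n-total p-prime n k l)
    where N : ℕ
          N = p ^ n
          x^[l*c]∈⟨x^l⟩ : ∀ {k} l c → k ≡ l * c [mod N ] → (x ^ℕ k) ∈⟨ x ^ℕ l ⟩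
          x^[l*c]∈⟨x^l⟩ = ≡multiple⇒^ℕ∈⟨^ℕ⟩ x N x^N≈ε
          instance _ = m^n≢0 p n {{prime⇒nonZero p-prime}}

CycleAdjacent : ℕ → ℕ → ℕ → Set
CycleAdjacent m a b = Next m a b ⊎ Next m b a

nonadjacent-neighbours-on-cycleℕ : ∀ {m t} → 4 ≤ m → t < m →
  ∃₂ λ a b → a < m × b < m × CycleAdjacent m t a × CycleAdjacent m t b × a ≢ b × ¬ CycleAdjacent m a b
nonadjacent-neighbours-on-cycleℕ {suc (suc (suc (suc m″)))} {zero} (s≤s (s≤s (s≤s (s≤s _)))) _ =
  suc (suc (suc m″)) , 1 , ≤-refl , s≤s (s≤s z≤n) , inj₂ (inj₂ (≡.refl , ≡.refl)) , inj₁ (inj₁ ≡.refl) ,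
  (λ ()) , λ { (inj₁ (inj₁ ())) ; (inj₁ (inj₂ (_ , ()))) ; (inj₂ (inj₁ ())) ; (inj₂ (inj₂ (() , _))) }
nonadjacent-neighbours-on-cycleℕ {suc (suc (suc (suc m″)))} {suc t′} (s≤s (s≤s (s≤s (s≤s _)))) t<m
  with m≤n⇒m<n∨m≡n t<m
... | inj₂ ≡.refl =
  suc (suc m″) , 0 , ≤-trans (n≤1+n _) t<m , s≤s z≤n , inj₂ (inj₁ ≡.refl) , inj₁ (inj₂ (≡.refl , ≡.refl)) ,
  (λ ()) , λ { (inj₁ (inj₁ ())) ; (inj₁ (inj₂ (3+m″≡4+m″ , _))) → 1+n≢n (≡.sym 3+m″≡4+m″)
             ; (inj₂ (inj₁ ())) ; (inj₂ (inj₂ (() , _))) }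
... | inj₁ 1+t<m =
  t′ , suc (suc t′) , ≤-trans (n≤1+n _) t<m , 1+t<m , inj₂ (inj₁ ≡.refl) , inj₁ (inj₁ ≡.refl) ,
  <⇒≢ (m≤n+m (suc t′) 1) ,
  λ { (inj₁ (inj₁ 2+t′≡1+t′)) → 1+n≢n (suc-injective 2+t′≡1+t′) ; (inj₁ (inj₂ (_ , ())))
    ; (inj₂ (inj₁ t′≡3+t′)) → <⇒≢ (m≤n+m (suc t′) 2) t′≡3+t′ ; (inj₂ (inj₂ (() , ≡.refl))) }

nonadjacent-neighbours-on-cycle : ∀ {m} → 4 ≤ m → (i : Fin m) →
  ∃₂ λ j k → CycleAdjacent m (toℕ i) (toℕ j) × CycleAdjacent m (toℕ i) (toℕ k) ×
             j ≢ k × ¬ CycleAdjacent m (toℕ j) (toℕ k)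
nonadjacent-neighbours-on-cycle {m} 4≤m i with nonadjacent-neighbours-on-cycleℕ 4≤m (toℕ<n i)
... | a , b , a<m , b<m , i~a , i~b , a≢b , a≁b =
  fromℕ< a<m , fromℕ< b<m ,
  subst (CycleAdjacent m (toℕ i)) (≡.sym toℕ-j≡a) i~a ,
  subst (CycleAdjacent m (toℕ i)) (≡.sym toℕ-k≡b) i~b ,
  (λ j≡k → a≢b (≡.trans (≡.sym toℕ-j≡a) (≡.trans (cong toℕ j≡k) toℕ-k≡b))) ,
  a≁b ∘ ≡.subst₂ (CycleAdjacent m) toℕ-j≡a toℕ-k≡b
  where
    toℕ-j≡a : toℕ (fromℕ< a<m) ≡ a
    toℕ-j≡a = toℕ-fromℕ< a<m
    toℕ-k≡b : toℕ (fromℕ< b<m) ≡ b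
    toℕ-k≡b = toℕ-fromℕ< b<m

even∧≥3⇒≥4 : ∀ {m} → 2 ∣ m → 3 ≤ m → 4 ≤ m
even∧≥3⇒≥4 2∣m 3≤m with m≤n⇒m<n∨m≡n 3≤m
... | inj₁ 3<m  = 3<m
... | inj₂ ≡.refl = ⊥-elim (2∤3 2∣m)
  where
    2∤3 : ¬ (2 ∣ 3)
    2∤3 (divides (suc (suc q)) ())

module _ {c ℓ : Level} (G : Group c ℓ) where
  open Group G
  open PowerGraph G

  hole-has-incomparable-neighbours : ∀ {m v} → IsHole m v → 4 ≤ m → ∀ i →
    ∃₂ λ j k → CycNbr i j × CycNbr i k × ¬ (v j ∈⟨ v k ⟩ ⊎ v k ∈⟨ v j ⟩)
  hole-has-incomparable-neighbours hole 4≤m i =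
    let (j , k , i~j , i~k , j≢k , j≁k) = nonadjacent-neighbours-on-cycle 4≤m i
    in j , k , i~j , i~k , λ comparable → j≁k (chordless j k (j≢k ∘ distinct j k , comparable))
    where open IsHole hole

theorem4 : ∀ {c ℓ : Level} (G : Group c ℓ) (p n : ℕ) → Prime p →
    let open Group G
        open PowerGraph G
    in (x : Carrier) → HasOrder x (p ^ n) →
       ∀ (m : ℕ) (v : Fin m → Carrier) → IsHole m v → 2 ∣ m →
       ∀ (i : Fin m) → v i ≈ x →
       ¬ (∀ (j : Fin m) → CycNbr i j → v j ∈⟨ x ⟩)
theorem4 G p n p-prime x (_ , x^pⁿ≈ε , _) m v hole 2∣m i _ neighbours∈⟨x⟩ =
  let 4≤m = even∧≥3⇒≥4 2∣m (IsHole.length≥3 hole)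
      (j , k , i~j , i~k , incomparable) = hole-has-incomparable-neighbours G hole 4≤m i
  in incomparable (∈⟨⟩-total-in-p-group p-prime n x x^pⁿ≈ε
                     (neighbours∈⟨x⟩ j i~j) (neighbours∈⟨x⟩ k i~k))
  where open PowerGraph G
        open CyclicSubgroups G
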